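{- Let $\alpha$ be an irrational real number with continued fraction expansion $\alpha=[a_0;a_1,a_2,\ldots]$. Let $k\ge 2$ and $0<l\le a_k$, and let $n$ be an integer with $0<n<q_{k,l}$. If $\|n\alpha\|<\|q_{k,l-1}\alpha\|$, then $n=mq_{k-1}$ for some integer $m$ with $1\le m\le \min\{l,\,a_k-l+1\}$.
   Context: For the irrational number $\alpha=[a_0;a_1,a_2,\ldots]$ (with $a_0\in\mathbb{Z}$ and $a_i$ positive integers for $i\ge1$), the denominators of the convergents are defined by $q_0=1$, $q_1=a_1$, and $q_k=a_kq_{k-1}+q_{k-2}$ for $k\ge 2$. For $k\ge 2$ and $0\le l\le a_k$ set $q_{k,l}=lq_{k-1}+q_{k-2}$ (so $q_{k,0}=q_{k-2}$ and $q_{k,a_k}=q_k$). For a real number $x$, $\|x\|=\min\{\{x\},1-\{x\}\}$ denotes the distance from $x$ to the nearest integer, where $\{x\}$ is the fractional part of $x$. -}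

module Defs where

open import Data.Nat as ℕ using (ℕ; zero; suc; _∸_)
open import Data.Integer as ℤ using (ℤ; +_; -[1+_]; _+_; _*_; -_; _-_; _<_; 0ℤ; 1ℤ)
open import Data.Product using (Σ; _×_; ∃)
open import Data.Sum using (_⊎_)

-- The integer part a0 : ℤ is given separately; the value  a 0  is ignored,
-- and  a i  (i ≥ 1) are the partial quotients (required positive elsewhere).

q : (ℕ → ℕ) → ℕ → ℕ
q a zero = 1
q a (suc zero) = a 1
q a (suc (suc k)) = a (suc (suc k)) ℕ.* q a (suc k) ℕ.+ q a k

p : ℤ → (ℕ → ℕ) → ℕ → ℤ
p a0 a zero = a0
p a0 a (suc zero) = + a 1 * a0 + 1ℤ
p a0 a (suc (suc k)) = + a (suc (suc k)) * p a0 a (suc k) + p a0 a k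

qkl : (ℕ → ℕ) → ℕ → ℕ → ℕ
qkl a k l = l ℕ.* q a (k ∸ 1) ℕ.+ q a (k ∸ 2)

data Even : ℕ → Set where
  ev0 : Even zero
  evSS : ∀ {k} → Even k → Even (suc (suc k))

Odd : ℕ → Set
Odd k = Even (suc k)

-- The real number α = [a0; a1, a2, ...] (a_i ≥ 1 for i ≥ 1) is determined by its
-- Dedekind cut.  Even convergents increase strictly to α, odd ones decrease strictly
-- to α, so for a rational r/s with s > 0:
--   r/s < α  iff  some even convergent p_k/q_k exceeds r/s,
--   α < r/s  iff  some odd convergent p_k/q_k is below r/s.
AlphaGt : ℤ → (ℕ → ℕ) → ℤ → ℤ → Set   -- r / s < α   (s > 0)
AlphaGt a0 a r s = Σ ℕ λ k → Even k × (r * + q a k < p a0 a k * s)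

AlphaLt : ℤ → (ℕ → ℕ) → ℤ → ℤ → Set   -- α < r / s   (s > 0)
AlphaLt a0 a r s = Σ ℕ λ k → Odd k × (p a0 a k * s < r * + q a k)

-- Pos a0 a x y  :  the real number  x α + y  is > 0
Pos : ℤ → (ℕ → ℕ) → ℤ → ℤ → Set
Pos a0 a (+ zero) y = 0ℤ < y
Pos a0 a (+ suc n) y = AlphaGt a0 a (- y) (+ suc n)
Pos a0 a -[1+ n ] y = AlphaLt a0 a y (+ suc n)

-- AbsLt a0 a x₁ y₁ x₂ y₂  :  | x₁ α + y₁ | < | x₂ α + y₂ |
-- (|A| < |B|  iff  (B - A > 0 and B + A > 0) or (A - B > 0 and -A - B > 0))
AbsLt : ℤ → (ℕ → ℕ) → ℤ → ℤ → ℤ → ℤ → Set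
AbsLt a0 a x₁ y₁ x₂ y₂ =
  (Pos a0 a (x₂ - x₁) (y₂ - y₁) × Pos a0 a (x₂ + x₁) (y₂ + y₁))
  ⊎ (Pos a0 a (x₁ - x₂) (y₁ - y₂) × Pos a0 a (- (x₁ + x₂)) (- (y₁ + y₂)))

-- NormLt a0 a n m  :  ‖ n α ‖ < ‖ m α ‖
-- (the distance to the nearest integer is attained, so this holds iff some
--  integer P satisfies |nα - P| < |mα - R| for every integer R)
NormLt : ℤ → (ℕ → ℕ) → ℕ → ℕ → Set
NormLt a0 a n m = Σ ℤ λ P → (R : ℤ) → AbsLt a0 a (+ n) (- P) (+ m) (- R)

{-# OPTIONS --safe #-}

-- α is only accessible through its convergents, and a strict inequality x α + y > 0 persists as
-- x p_j + y q_j > 0 for all large j, because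
--   q_i (x p_j + y q_j) = x (q_i p_j − p_i q_j) + q_j (x p_i + y q_i)
-- and q_i p_j − p_i q_j has the sign of (−1)^i.  The convergent vectors (q_{k−1}, p_{k−1}) and
-- (q_{k−2}, p_{k−2}) form a basis of ℤ², so n = U q_{k−1} + V q_{k−2}.  At a late convergent j the
-- numbers ∣q_i p_j − p_i q_j∣ are continuants c = a_k d + e (i = k − 2), d (i = k − 1), e (i = k) with
-- e ≤ d, and ‖nα‖ < ‖q_{k,l−1} α‖ (tested against p_{k,l−1}) becomes ∣V c − U d∣ < c − (l − 1) d.
-- Together with 0 < n < q_{k,l} this linear inequality forces V = 0 and 1 ≤ U ≤ min(l, a_k − l + 1).

module Submission where

open import Defs
open import Data.Empty using (⊥-elim)
open import Data.Integer.Base using (ℤ; +_; +0; +[1+_]; -[1+_]; 0ℤ; 1ℤ; -1ℤ; +≤+; +<+)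
import Data.Integer.Properties as ℤ
open import Data.Integer.Tactic.RingSolver using (solve-∀)
open import Data.Nat.Base as ℕ using (ℕ; zero; suc; z≤n; s≤s)
import Data.Nat.Properties as ℕ
open import Data.Product.Base using (Σ; _×_; _,_)
open import Data.Sum.Base using (_⊎_; inj₁; inj₂)
open import Relation.Binary.PropositionalEquality
open import Relation.Nullary.Decidable using (yes; no)

Eventually : (ℕ → Set) → Set
Eventually P = Σ ℕ λ N → ∀ j → N ℕ.≤ j → P j

eventually-zipWith : ∀ {P Q R : ℕ → Set} → (∀ j → P j → Q j → R j) →
                     Eventually P → Eventually Q → Eventually R
eventually-zipWith f (M , p) (N , q) = M ℕ.⊔ N , λ j M⊔N≤j →
  f j (p j (ℕ.m⊔n≤o⇒m≤o M N M⊔N≤j)) (q j (ℕ.m⊔n≤o⇒n≤o M N M⊔N≤j))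

module _ where
  open import Data.Nat.Base using (_≤_; _<_; _+_; _*_)
  open ℕ.≤-Reasoning

  m*q<l*q+q′⇒m≤l : ∀ {m l q q′} → q′ ≤ q → m * q < l * q + q′ → m ≤ l
  m*q<l*q+q′⇒m≤l {m} {l} {q} {q′} q′≤q m*q<l*q+q′ = ℕ.≮⇒≥ λ l<m → ℕ.<-irrefl refl (begin-strict
    m * q           <⟨ m*q<l*q+q′ ⟩
    l * q + q′      ≤⟨ ℕ.+-monoʳ-≤ (l * q) q′≤q ⟩
    l * q + q       ≡⟨ ℕ.+-comm (l * q) q ⟩
    suc l * q       ≤⟨ ℕ.*-monoˡ-≤ q l<m ⟩
    m * q           ∎)

module Continuants (a : ℕ → ℕ) (a-pos : ∀ i → 1 ℕ.≤ i → 1 ℕ.≤ a i) where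
  open import Data.Nat.Base using (_≤_; _+_; _*_)

  m≤a*m : ∀ i m → m ≤ a (suc i) * m
  m≤a*m i m = ℕ.m≤n*m m (a (suc i)) {{ℕ.>-nonZero (a-pos (suc i) (s≤s z≤n))}}

  q-pos : ∀ j → 1 ≤ q a j
  q-pos zero = ℕ.≤-refl
  q-pos (suc zero) = a-pos 1 ℕ.≤-refl
  q-pos (suc (suc j)) = ℕ.≤-trans (q-pos j) (ℕ.m≤n+m _ _)

  q-mono : ∀ j → q a j ≤ q a (suc j)
  q-mono zero = a-pos 1 ℕ.≤-refl
  q-mono (suc j) = ℕ.≤-trans (m≤a*m (suc j) _) (ℕ.m≤m+n _ _)

  -- The continuant of a (i + 2), …, a (i + t), expanded from the left; it is ∣ Δ i (t + i) ∣ below.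
  K : ℕ → ℕ → ℕ
  K i zero = 0
  K i (suc zero) = 1
  K i (suc (suc t)) = a (suc (suc i)) * K (suc i) (suc t) + K (suc (suc i)) t

  K-step : ∀ i t → K (suc (suc i)) t ≤ K (suc i) (suc t)
  K-step i zero = z≤n
  K-step i (suc t) = ℕ.≤-trans (m≤a*m (suc (suc i)) _) (ℕ.m≤m+n _ _)

module _ where
  open import Data.Integer.Base using (_+_; _-_; _*_; -_; _^_; _≤_; _<_)

  pos-*-+ : ∀ m n o → + (m ℕ.* n ℕ.+ o) ≡ + m * + n + + o
  pos-*-+ m n o = trans (ℤ.pos-+ (m ℕ.* n) o) (cong (_+ + o) (ℤ.pos-* m n))

  *-nonNeg : ∀ {i} → 0ℤ ≤ i → ∀ n → 0ℤ ≤ i * + n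
  *-nonNeg {+ m} _ n = subst (0ℤ ≤_) (ℤ.pos-* m n) (+≤+ z≤n)

  +*+-nonNeg : ∀ m n → 0ℤ ≤ + m * + n
  +*+-nonNeg m = *-nonNeg {+ m} (+≤+ z≤n)

  *-pos : ∀ {i j} → 0ℤ < i → 0ℤ < j → 0ℤ < i * j
  *-pos {+[1+ m ]} {+[1+ n ]} _ _ = +<+ (s≤s z≤n)
  *-pos {+0} (+<+ ())
  *-pos {+[1+ m ]} {+0} _ (+<+ ())

  i<j⇒0<j-i : ∀ {i j} → i < j → 0ℤ < j - i
  i<j⇒0<j-i {i} {j} i<j = subst (_< j - i) (ℤ.+-inverseʳ i) (ℤ.+-monoˡ-< (- i) i<j)

  parity : ∀ i → Even i ⊎ Odd i
  parity zero = inj₁ ev0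
  parity (suc i) with parity i
  ... | inj₁ even = inj₂ (evSS even)
  ... | inj₂ odd = inj₁ odd

  even⇒-1^i≡1 : ∀ {i} → Even i → -1ℤ ^ i ≡ 1ℤ
  even⇒-1^i≡1 ev0 = refl
  even⇒-1^i≡1 (evSS even) = cong (λ s → -1ℤ * (-1ℤ * s)) (even⇒-1^i≡1 even)

  odd⇒-1^i≡-1 : ∀ {i} → Odd i → -1ℤ ^ i ≡ -1ℤ
  odd⇒-1^i≡-1 {suc i} (evSS even) = cong (-1ℤ *_) (even⇒-1^i≡1 even)

  -1^i≡1⊎-1^i≡-1 : ∀ i → -1ℤ ^ i ≡ 1ℤ ⊎ -1ℤ ^ i ≡ -1ℤ
  -1^i≡1⊎-1^i≡-1 i with parity i
  ... | inj₁ even = inj₁ (even⇒-1^i≡1 even)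
  ... | inj₂ odd = inj₂ (odd⇒-1^i≡-1 odd)

  -1^i*-1^i≡1 : ∀ i → -1ℤ ^ i * -1ℤ ^ i ≡ 1ℤ
  -1^i*-1^i≡1 i with -1^i≡1⊎-1^i≡-1 i
  ... | inj₁ s≡1 = cong₂ _*_ s≡1 s≡1
  ... | inj₂ s≡-1 = cong₂ _*_ s≡-1 s≡-1

  ∣_∣<∣_∣ : ℤ → ℤ → Set
  ∣ A ∣<∣ B ∣ = (0ℤ < B - A × 0ℤ < B + A) ⊎ (0ℤ < A - B × 0ℤ < - A - B)

  ∣∣<∣∣-neg : ∀ {A B} → ∣ A ∣<∣ B ∣ → ∣ - A ∣<∣ - B ∣
  ∣∣<∣∣-neg {A} {B} (inj₁ (p , q)) = inj₂ (subst (0ℤ <_) (flip A B) p , subst (0ℤ <_) (sum A B) q)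
    where
    flip : ∀ A B → B - A ≡ - A - - B
    flip = solve-∀
    sum : ∀ A B → B + A ≡ - - A - - B
    sum = solve-∀
  ∣∣<∣∣-neg {A} {B} (inj₂ (p , q)) = inj₁ (subst (0ℤ <_) (flip A B) p , subst (0ℤ <_) (sum A B) q)
    where
    flip : ∀ A B → A - B ≡ - B - - A
    flip = solve-∀
    sum : ∀ A B → - A - B ≡ - B + - A
    sum = solve-∀

  ∣∣<∣∣-cancel-±1 : ∀ {s A B} → s ≡ 1ℤ ⊎ s ≡ -1ℤ → ∣ s * A ∣<∣ s * B ∣ → ∣ A ∣<∣ B ∣
  ∣∣<∣∣-cancel-±1 {A = A} {B} (inj₁ refl) = subst₂ ∣_∣<∣_∣ (ℤ.*-identityˡ A) (ℤ.*-identityˡ B)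
  ∣∣<∣∣-cancel-±1 {A = A} {B} (inj₂ refl) h =
    subst₂ ∣_∣<∣_∣ (ℤ.neg-involutive A) (ℤ.neg-involutive B)
      (∣∣<∣∣-neg { - A} { - B} (subst₂ ∣_∣<∣_∣ (ℤ.-1*i≡-i A) (ℤ.-1*i≡-i B) h))

  -- Each impossible case below is refuted by a certificate: a sum of positive and nonnegative
  -- terms that the ring solver shows to be identically 0.
  ∣∣<∣∣-nonNeg : ∀ {A B} → 0ℤ ≤ B → ∣ A ∣<∣ B ∣ → 0ℤ < B - A × 0ℤ < B + A
  ∣∣<∣∣-nonNeg _ (inj₁ lt) = lt
  ∣∣<∣∣-nonNeg {A} {B} 0≤B (inj₂ (p , q)) =
    ⊥-elim (ℤ.<-irrefl (sym (certificate A B)) (ℤ.+-mono-<-≤ (ℤ.+-mono-<-≤ (ℤ.+-mono-< p q) 0≤B) 0≤B))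
    where
    certificate : ∀ A B → (A - B) + (- A - B) + B + B ≡ 0ℤ
    certificate = solve-∀

  q₀-coordinate-vanishes : ∀ {l c d Q₀ Q₁ : ℕ} {U V : ℤ} →
    0ℤ < U * + Q₁ + V * + Q₀ → U * + Q₁ + V * + Q₀ < + suc l * + Q₁ + + Q₀ →
    0ℤ < (+ c - + l * + d) - (V * + c - U * + d) → 0ℤ < (+ c - + l * + d) + (V * + c - U * + d) →
    V ≡ 0ℤ
  q₀-coordinate-vanishes {V = +0} _ _ _ _ = refl
  q₀-coordinate-vanishes {l} {c} {d} {Q₀} {Q₁} {U} {+[1+ v ]} _ n<q lt₁ _ with U ℤ.≤? + l
  ... | yes U≤l = ⊥-elim (ℤ.<-irrefl (sym (certificate (+ c) (+ l) U (+ d) (+ v)))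
          (ℤ.+-mono-<-≤ (ℤ.+-mono-<-≤ lt₁ (+*+-nonNeg v c)) (*-nonNeg (ℤ.i≤j⇒0≤j-i U≤l) d)))
    where
    certificate : ∀ C L U D v → ((C - L * D) - ((1ℤ + v) * C - U * D)) + v * C + (L - U) * D ≡ 0ℤ
    certificate = solve-∀
  ... | no U≰l = ⊥-elim (ℤ.<-irrefl (sym (certificate (+ l) (+ Q₁) (+ Q₀) U (+ v)))
          (ℤ.+-mono-<-≤ (ℤ.+-mono-<-≤ (i<j⇒0<j-i n<q) (*-nonNeg (ℤ.i≤j⇒0≤j-i (ℤ.i<j⇒suc[i]≤j (ℤ.≰⇒> U≰l))) Q₁))
            (+*+-nonNeg v Q₀)))
    where
    certificate : ∀ L Q₁ Q₀ U v → ((1ℤ + L) * Q₁ + Q₀ - (U * Q₁ + (1ℤ + v) * Q₀)) + (U - (1ℤ + L)) * Q₁ + v * Q₀ ≡ 0ℤ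
    certificate = solve-∀
  q₀-coordinate-vanishes {l} {c} {d} {Q₀} {Q₁} {U} { -[1+ v ]} 0<n _ _ lt₂ with U ℤ.≤? 0ℤ
  ... | yes U≤0 = ⊥-elim (ℤ.<-irrefl (sym (certificate U (+ Q₁) (+ Q₀) (+ v)))
          (ℤ.+-mono-<-≤ (ℤ.+-mono-<-≤ 0<n (*-nonNeg (ℤ.neg-mono-≤ U≤0) Q₁)) (+*+-nonNeg (suc v) Q₀)))
    where
    certificate : ∀ U Q₁ Q₀ v → (U * Q₁ + (- (1ℤ + v)) * Q₀) + (- U) * Q₁ + (1ℤ + v) * Q₀ ≡ 0ℤ
    certificate = solve-∀
  ... | no U≰0 = ⊥-elim (ℤ.<-irrefl (sym (certificate (+ c) (+ l) U (+ d) (+ v)))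
          (ℤ.+-mono-<-≤ (ℤ.+-mono-<-≤ (ℤ.+-mono-<-≤ lt₂ (+*+-nonNeg v c)) (+*+-nonNeg l d))
            (*-nonNeg (ℤ.<⇒≤ (ℤ.≰⇒> U≰0)) d)))
    where
    certificate : ∀ C L U D v → ((C - L * D) + ((- (1ℤ + v)) * C - U * D)) + v * C + L * D + U * D ≡ 0ℤ
    certificate = solve-∀

  excess≡ : ∀ l r {c} d e → c ≡ (suc l ℕ.+ r) ℕ.* d ℕ.+ e → + c - + l * + d ≡ + suc r * + d + + e
  excess≡ l r {c} d e c≡ = begin
    + c - + l * + d                               ≡⟨ cong (λ C → C - + l * + d) (cong +_ c≡) ⟩
    + ((suc l ℕ.+ r) ℕ.* d ℕ.+ e) - + l * + d      ≡⟨ cong (λ C → C - + l * + d) (pos-*-+ (suc l ℕ.+ r) d e) ⟩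
    + (suc l ℕ.+ r) * + d + + e - + l * + d        ≡⟨ cong (λ A → A * + d + + e - + l * + d) (ℤ.pos-+ (suc l) r) ⟩
    (1ℤ + + l + + r) * + d + + e - + l * + d       ≡⟨ cancel (+ l) (+ r) (+ d) (+ e) ⟩
    + suc r * + d + + e                           ∎
    where
    open ≡-Reasoning
    cancel : ∀ L R D E → (1ℤ + L + R) * D + E - L * D ≡ (1ℤ + R) * D + E
    cancel = solve-∀

  q₁-coordinate-bounds : ∀ {l r c d e n Q₀ Q₁ : ℕ} {U : ℤ} →
    + c - + l * + d ≡ + suc r * + d + + e → e ℕ.≤ d → Q₀ ℕ.≤ Q₁ →
    0 ℕ.< n → n ℕ.< suc l ℕ.* Q₁ ℕ.+ Q₀ → + n ≡ U * + Q₁ + 0ℤ * + Q₀ →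
    0ℤ < (+ c - + l * + d) + (0ℤ * + c - U * + d) →
    Σ ℕ λ m → 1 ℕ.≤ m × m ℕ.≤ suc l × m ℕ.≤ suc r × n ≡ m ℕ.* Q₁
  q₁-coordinate-bounds {U = +0} _ _ _ 0<n _ n≡ _ = ⊥-elim (ℕ.<⇒≢ 0<n (sym (ℤ.+-injective n≡)))
  q₁-coordinate-bounds {n = n} {Q₀} {Q₁} { -[1+ u ]} _ _ _ 0<n _ n≡ _ =
    ⊥-elim (ℤ.<-irrefl (sym (certificate (+ suc u) (+ Q₁) (+ Q₀)))
      (subst (λ N → 0ℤ < N + + suc u * + Q₁) n≡ (ℤ.+-mono-<-≤ (+<+ 0<n) (+*+-nonNeg (suc u) Q₁))))
    where
    certificate : ∀ M Q₁ Q₀ → ((- M) * Q₁ + 0ℤ * Q₀) + M * Q₁ ≡ 0ℤ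
    certificate = solve-∀
  q₁-coordinate-bounds {l} {r} {c} {d} {e} {n} {Q₀} {Q₁} {+[1+ u ]} Y≡ e≤d Q₀≤Q₁ 0<n n<q n≡ lt =
    suc u , s≤s z≤n , m*q<l*q+q′⇒m≤l Q₀≤Q₁ (subst (ℕ._< _) n≡m*Q₁ n<q) , m≤1+r , n≡m*Q₁
    where
    n≡m*Q₁ : n ≡ suc u ℕ.* Q₁
    n≡m*Q₁ = ℤ.+-injective (trans n≡ (trans (ℤ.+-identityʳ _) (sym (ℤ.pos-* (suc u) Q₁))))
    m≤1+r : suc u ℕ.≤ suc r
    m≤1+r with u ℕ.≤? r
    ... | yes u≤r = s≤s u≤r
    ... | no u≰r with ℕ.m≤n⇒∃[o]m+o≡n (ℕ.≰⇒> u≰r)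
    ...   | s , refl = ⊥-elim (ℤ.<-irrefl (sym (certificate (+ c) (+ r) (+ d) (+ e) (+ s)))
            (ℤ.+-mono-<-≤ (ℤ.+-mono-<-≤ (subst (λ Y → 0ℤ < Y + (0ℤ * + c - +[1+ suc r ℕ.+ s ] * + d)) Y≡ lt)
              (+*+-nonNeg s d)) (ℤ.i≤j⇒0≤j-i (+≤+ e≤d))))
      where
      certificate : ∀ C R D E S →
        ((1ℤ + R) * D + E + (0ℤ * C - (1ℤ + (1ℤ + R + S)) * D)) + S * D + (D - E) ≡ 0ℤ
      certificate = solve-∀

  small-multiple : ∀ {l r c d e n Q₀ Q₁ : ℕ} {U V : ℤ} →
    c ≡ (suc l ℕ.+ r) ℕ.* d ℕ.+ e → e ℕ.≤ d → Q₀ ℕ.≤ Q₁ →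
    0 ℕ.< n → n ℕ.< suc l ℕ.* Q₁ ℕ.+ Q₀ → + n ≡ U * + Q₁ + V * + Q₀ →
    ∣ V * + c - U * + d ∣<∣ + c - + l * + d ∣ →
    Σ ℕ λ m → 1 ℕ.≤ m × m ℕ.≤ suc l × m ℕ.≤ suc r × n ≡ m ℕ.* Q₁
  small-multiple {l} {r} {c} {d} {e} {n} {Q₀} {Q₁} {U} {V} c≡ e≤d Q₀≤Q₁ 0<n n<q n≡ abs
    with ∣∣<∣∣-nonNeg (subst (0ℤ ≤_) (sym (excess≡ l r d e c≡)) (ℤ.+-mono-≤ (+*+-nonNeg (suc r) d) (+≤+ z≤n))) abs
  ... | lt₁ , lt₂
    with q₀-coordinate-vanishes {l} {c} {d} {Q₀} {Q₁} {U} {V}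
           (subst (0ℤ <_) n≡ (+<+ 0<n)) (subst₂ _<_ n≡ (pos-*-+ (suc l) Q₁ Q₀) (+<+ n<q)) lt₁ lt₂
  ... | refl = q₁-coordinate-bounds {l} {r} {c} {d} {e} {n} {Q₀} {Q₁} {U} (excess≡ l r d e c≡) e≤d Q₀≤Q₁ 0<n n<q n≡ lt₂

module Convergents (a0 : ℤ) (a : ℕ → ℕ) (a-pos : ∀ i → 1 ℕ.≤ i → 1 ℕ.≤ a i) where
  open import Data.Integer.Base using (_+_; _-_; _*_; -_; _^_; _≤_; _<_)
  open Continuants a a-pos
  open ≡-Reasoning

  P Q : ℕ → ℤ
  P = p a0 a
  Q j = + q a j

  Q-rec : ∀ i → Q (suc (suc i)) ≡ + a (suc (suc i)) * Q (suc i) + Q i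
  Q-rec i = pos-*-+ (a (suc (suc i))) (q a (suc i)) (q a i)

  Δ : ℕ → ℕ → ℤ
  Δ i j = Q i * P j - P i * Q j

  Δ-recˡ : ∀ i j → Δ (suc (suc i)) j ≡ + a (suc (suc i)) * Δ (suc i) j + Δ i j
  Δ-recˡ i j = begin
    Q (suc (suc i)) * P j - P (suc (suc i)) * Q j
      ≡⟨ cong (λ x → x * P j - P (suc (suc i)) * Q j) (Q-rec i) ⟩
    (A * Q (suc i) + Q i) * P j - (A * P (suc i) + P i) * Q j
      ≡⟨ expand A (Q (suc i)) (Q i) (P (suc i)) (P i) (P j) (Q j) ⟩
    A * Δ (suc i) j + Δ i j ∎
    where
    A = + a (suc (suc i))
    expand : ∀ A Q₁ Q₀ P₁ P₀ Pⱼ Qⱼ →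
      (A * Q₁ + Q₀) * Pⱼ - (A * P₁ + P₀) * Qⱼ ≡ A * (Q₁ * Pⱼ - P₁ * Qⱼ) + (Q₀ * Pⱼ - P₀ * Qⱼ)
    expand = solve-∀

  Δ-consecutive : ∀ i → Δ i (suc i) ≡ -1ℤ ^ i
  Δ-consecutive zero = base (+ a 1) a0
    where
    base : ∀ A x → 1ℤ * (A * x + 1ℤ) - x * A ≡ 1ℤ
    base = solve-∀
  Δ-consecutive (suc i) = begin
    Δ (suc i) (suc (suc i))
      ≡⟨ cong (λ x → Q (suc i) * P (suc (suc i)) - P (suc i) * x) (Q-rec i) ⟩
    Q (suc i) * (A * P (suc i) + P i) - P (suc i) * (A * Q (suc i) + Q i)
      ≡⟨ swap (Q (suc i)) (P (suc i)) A (P i) (Q i) ⟩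
    -1ℤ * Δ i (suc i)
      ≡⟨ cong (-1ℤ *_) (Δ-consecutive i) ⟩
    -1ℤ ^ suc i ∎
    where
    A = + a (suc (suc i))
    swap : ∀ Q₁ P₁ A P₀ Q₀ → Q₁ * (A * P₁ + P₀) - P₁ * (A * Q₁ + Q₀) ≡ -1ℤ * (Q₀ * P₁ - P₀ * Q₁)
    swap = solve-∀

  Δ-continuant : ∀ i {j} t → t ℕ.+ i ≡ j → Δ i j ≡ -1ℤ ^ i * + K i t
  Δ-continuant i zero refl = diagonal (Q i) (P i) (-1ℤ ^ i)
    where
    diagonal : ∀ x y s → x * y - y * x ≡ s * 0ℤ
    diagonal = solve-∀
  Δ-continuant i (suc zero) refl = trans (Δ-consecutive i) (sym (ℤ.*-identityʳ _))
  Δ-continuant i (suc (suc t)) refl = begin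
    Δ i j
      ≡⟨ isolate (Δ (suc (suc i)) j) (Δ (suc i) j) (Δ i j) A (Δ-recˡ i j) ⟩
    Δ (suc (suc i)) j - A * Δ (suc i) j
      ≡⟨ cong₂ (λ x y → x - A * y) (Δ-continuant (suc (suc i)) t (trans (ℕ.+-suc t (suc i)) (cong suc (ℕ.+-suc t i))))
                                   (Δ-continuant (suc i) (suc t) (cong suc (ℕ.+-suc t i))) ⟩
    -1ℤ * (-1ℤ * s) * + K (suc (suc i)) t - A * (-1ℤ * s * + K (suc i) (suc t))
      ≡⟨ collect s A (+ K (suc i) (suc t)) (+ K (suc (suc i)) t) ⟩
    s * (A * + K (suc i) (suc t) + + K (suc (suc i)) t)
      ≡⟨ cong (s *_) (sym (pos-*-+ (a (suc (suc i))) (K (suc i) (suc t)) (K (suc (suc i)) t))) ⟩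
    s * + K i (suc (suc t)) ∎
    where
    j = suc (suc t) ℕ.+ i
    s = -1ℤ ^ i
    A = + a (suc (suc i))
    isolate : ∀ x y z A → x ≡ A * y + z → z ≡ x - A * y
    isolate x y z A x≡ = trans (cancel z A y) (cong (_- A * y) (sym x≡))
      where
      cancel : ∀ z A y → z ≡ A * y + z - A * y
      cancel = solve-∀
    collect : ∀ s A K₁ K₂ → -1ℤ * (-1ℤ * s) * K₂ - A * (-1ℤ * s * K₁) ≡ s * (A * K₁ + K₂)
    collect = solve-∀

  -- L x y j is q_j (x α + y) with α replaced by its convergent p_j / q_j.
  L : ℤ → ℤ → ℕ → ℤ
  L x y j = x * P j + y * Q j

  L-shift : ∀ x y i j → Q i * L x y j ≡ x * Δ i j + Q j * L x y i
  L-shift x y i j = identity (Q i) (P i) (Q j) (P j) x y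
    where
    identity : ∀ Qᵢ Pᵢ Qⱼ Pⱼ x y → Qᵢ * (x * Pⱼ + y * Qⱼ) ≡ x * (Qᵢ * Pⱼ - Pᵢ * Qⱼ) + Qⱼ * (x * Pᵢ + y * Qᵢ)
    identity = solve-∀

  L-positive-beyond : ∀ x y i → 0ℤ < L x y i → (∀ j → i ℕ.≤ j → 0ℤ ≤ x * Δ i j) →
                      ∀ j → i ℕ.≤ j → 0ℤ < L x y j
  L-positive-beyond x y i 0<Lᵢ 0≤xΔ j i≤j =
    ℤ.*-cancelˡ-<-nonNeg (Q i) (subst₂ _<_ (sym (ℤ.*-zeroʳ (Q i))) (sym (L-shift x y i j))
      (ℤ.+-mono-≤-< (0≤xΔ j i≤j) (*-pos (+<+ (q-pos j)) 0<Lᵢ)))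

  Δ-beyond : ∀ {i j} → i ℕ.≤ j → Δ i j ≡ -1ℤ ^ i * + K i (j ℕ.∸ i)
  Δ-beyond {i} {j} i≤j = Δ-continuant i (j ℕ.∸ i) (ℕ.m∸n+n≡m i≤j)

  pos⇒eventually : ∀ x y → Pos a0 a x y → Eventually (λ j → 0ℤ < L x y j)
  pos⇒eventually +0 y 0<y = 0 , L-positive-beyond +0 y 0 (subst (0ℤ <_) (y≡ a0 y) 0<y) (λ _ _ → ℤ.≤-refl)
    where
    y≡ : ∀ a0 y → y ≡ 0ℤ * a0 + y * 1ℤ
    y≡ = solve-∀
  pos⇒eventually +[1+ n ] y (i , even , lt) = i , L-positive-beyond +[1+ n ] y i 0<Lᵢ 0≤xΔ
    where
    rearrange : ∀ x y Pᵢ Qᵢ → Pᵢ * x - (- y) * Qᵢ ≡ x * Pᵢ + y * Qᵢ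
    rearrange = solve-∀
    0<Lᵢ : 0ℤ < L +[1+ n ] y i
    0<Lᵢ = subst (0ℤ <_) (rearrange +[1+ n ] y (P i) (Q i)) (i<j⇒0<j-i lt)
    0≤xΔ : ∀ j → i ℕ.≤ j → 0ℤ ≤ +[1+ n ] * Δ i j
    0≤xΔ j i≤j rewrite Δ-beyond i≤j | even⇒-1^i≡1 even | ℤ.*-identityˡ (+ K i (j ℕ.∸ i)) = +*+-nonNeg (suc n) _
  pos⇒eventually -[1+ n ] y (i , odd , lt) = i , L-positive-beyond -[1+ n ] y i 0<Lᵢ 0≤xΔ
    where
    rearrange : ∀ x y Pᵢ Qᵢ → y * Qᵢ - Pᵢ * x ≡ (- x) * Pᵢ + y * Qᵢ
    rearrange = solve-∀
    0<Lᵢ : 0ℤ < L -[1+ n ] y i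
    0<Lᵢ = subst (0ℤ <_) (rearrange +[1+ n ] y (P i) (Q i)) (i<j⇒0<j-i lt)
    signs : ∀ x κ → (- x) * (-1ℤ * κ) ≡ x * κ
    signs = solve-∀
    0≤xΔ : ∀ j → i ℕ.≤ j → 0ℤ ≤ -[1+ n ] * Δ i j
    0≤xΔ j i≤j rewrite Δ-beyond i≤j | odd⇒-1^i≡-1 odd = subst (0ℤ ≤_) (sym (signs +[1+ n ] _)) (+*+-nonNeg (suc n) _)

  L-+ : ∀ x y x′ y′ j → L (x + x′) (y + y′) j ≡ L x y j + L x′ y′ j
  L-+ x y x′ y′ j = distrib x y x′ y′ (P j) (Q j)
    where
    distrib : ∀ x y x′ y′ p q → (x + x′) * p + (y + y′) * q ≡ (x * p + y * q) + (x′ * p + y′ * q)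
    distrib = solve-∀

  L-- : ∀ x y x′ y′ j → L (x - x′) (y - y′) j ≡ L x y j - L x′ y′ j
  L-- x y x′ y′ j = distrib x y x′ y′ (P j) (Q j)
    where
    distrib : ∀ x y x′ y′ p q → (x - x′) * p + (y - y′) * q ≡ (x * p + y * q) - (x′ * p + y′ * q)
    distrib = solve-∀

  L-neg-+ : ∀ x y x′ y′ j → L (- (x + x′)) (- (y + y′)) j ≡ - L x y j - L x′ y′ j
  L-neg-+ x y x′ y′ j = distrib x y x′ y′ (P j) (Q j)
    where
    distrib : ∀ x y x′ y′ p q → (- (x + x′)) * p + (- (y + y′)) * q ≡ - (x * p + y * q) - (x′ * p + y′ * q)
    distrib = solve-∀

  absLt⇒eventually : ∀ x₁ y₁ x₂ y₂ → AbsLt a0 a x₁ y₁ x₂ y₂ →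
                     Eventually (λ j → ∣ L x₁ y₁ j ∣<∣ L x₂ y₂ j ∣)
  absLt⇒eventually x₁ y₁ x₂ y₂ (inj₁ (pos₋ , pos₊)) =
    eventually-zipWith close (pos⇒eventually (x₂ - x₁) (y₂ - y₁) pos₋) (pos⇒eventually (x₂ + x₁) (y₂ + y₁) pos₊)
    where
    close : ∀ j → 0ℤ < L (x₂ - x₁) (y₂ - y₁) j → 0ℤ < L (x₂ + x₁) (y₂ + y₁) j → ∣ L x₁ y₁ j ∣<∣ L x₂ y₂ j ∣
    close j 0<L₋ 0<L₊ = inj₁ (subst (0ℤ <_) (L-- x₂ y₂ x₁ y₁ j) 0<L₋ , subst (0ℤ <_) (L-+ x₂ y₂ x₁ y₁ j) 0<L₊)
  absLt⇒eventually x₁ y₁ x₂ y₂ (inj₂ (pos₋ , pos₊)) =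
    eventually-zipWith close (pos⇒eventually (x₁ - x₂) (y₁ - y₂) pos₋) (pos⇒eventually (- (x₁ + x₂)) (- (y₁ + y₂)) pos₊)
    where
    close : ∀ j → 0ℤ < L (x₁ - x₂) (y₁ - y₂) j → 0ℤ < L (- (x₁ + x₂)) (- (y₁ + y₂)) j → ∣ L x₁ y₁ j ∣<∣ L x₂ y₂ j ∣
    close j 0<L₋ 0<L₊ = inj₂ (subst (0ℤ <_) (L-- x₁ y₁ x₂ y₂ j) 0<L₋ , subst (0ℤ <_) (L-neg-+ x₁ y₁ x₂ y₂ j) 0<L₊)

  convergent-basis : ∀ i x y → Σ ℤ λ U → Σ ℤ λ V →
    x ≡ U * Q (suc i) + V * Q i × y ≡ U * P (suc i) + V * P i
  convergent-basis i x y = U , V , x≡ , y≡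
    where
    s = Δ i (suc i)
    U = s * (y * Q i - x * P i)
    V = s * (x * P (suc i) - y * Q (suc i))
    unit : ∀ z → z ≡ s * s * z
    unit z = sym (trans (cong (_* z) (trans (cong₂ _*_ (Δ-consecutive i) (Δ-consecutive i)) (-1^i*-1^i≡1 i)))
                        (ℤ.*-identityˡ z))
    cramer₁ : ∀ s x y Q₀ Q₁ P₀ P₁ →
      s * (Q₀ * P₁ - P₀ * Q₁) * x ≡ s * (y * Q₀ - x * P₀) * Q₁ + s * (x * P₁ - y * Q₁) * Q₀
    cramer₁ = solve-∀
    cramer₂ : ∀ s x y Q₀ Q₁ P₀ P₁ →
      s * (Q₀ * P₁ - P₀ * Q₁) * y ≡ s * (y * Q₀ - x * P₀) * P₁ + s * (x * P₁ - y * Q₁) * P₀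
    cramer₂ = solve-∀
    x≡ : x ≡ U * Q (suc i) + V * Q i
    x≡ = trans (unit x) (cramer₁ s x y (Q i) (Q (suc i)) (P i) (P (suc i)))
    y≡ : y ≡ U * P (suc i) + V * P i
    y≡ = trans (unit y) (cramer₂ s x y (Q i) (Q (suc i)) (P i) (P (suc i)))

  L-on-basis : ∀ i t {x y} U V → x ≡ U * Q (suc i) + V * Q i → y ≡ U * P (suc i) + V * P i →
    L x (- y) (suc (suc t) ℕ.+ i) ≡ -1ℤ ^ i * (V * + K i (suc (suc t)) - U * + K (suc i) (suc t))
  L-on-basis i t U V refl refl = begin
    L (U * Q (suc i) + V * Q i) (- (U * P (suc i) + V * P i)) j
      ≡⟨ regroup U V (Q (suc i)) (Q i) (P (suc i)) (P i) (P j) (Q j) ⟩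
    U * Δ (suc i) j + V * Δ i j
      ≡⟨ cong₂ (λ d c → U * d + V * c) (Δ-continuant (suc i) (suc t) (cong suc (ℕ.+-suc t i)))
                                       (Δ-continuant i (suc (suc t)) refl) ⟩
    U * (-1ℤ * s * + K (suc i) (suc t)) + V * (s * + K i (suc (suc t)))
      ≡⟨ collect s U V (+ K i (suc (suc t))) (+ K (suc i) (suc t)) ⟩
    s * (V * + K i (suc (suc t)) - U * + K (suc i) (suc t)) ∎
    where
    j = suc (suc t) ℕ.+ i
    s = -1ℤ ^ i
    regroup : ∀ U V Q₁ Q₀ P₁ P₀ Pⱼ Qⱼ →
      (U * Q₁ + V * Q₀) * Pⱼ + (- (U * P₁ + V * P₀)) * Qⱼ ≡ U * (Q₁ * Pⱼ - P₁ * Qⱼ) + V * (Q₀ * Pⱼ - P₀ * Qⱼ)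
    regroup = solve-∀
    collect : ∀ s U V c d → U * (-1ℤ * s * d) + V * (s * c) ≡ s * (V * c - U * d)
    collect = solve-∀

  -- The case k = i + 2 of the theorem, with the paper's l equal to suc l.  ‖nα‖ is compared with
  -- the distance from q_{k,l−1} α to the integer R = p_{k,l−1}.
  normLt⇒small-multiple : ∀ i l r n P′ → a (suc (suc i)) ≡ suc l ℕ.+ r →
    0 ℕ.< n → n ℕ.< suc l ℕ.* q a (suc i) ℕ.+ q a i →
    (∀ R → AbsLt a0 a (+ n) (- P′) (+ (l ℕ.* q a (suc i) ℕ.+ q a i)) (- R)) →
    Σ ℕ λ m → 1 ℕ.≤ m × m ℕ.≤ suc l × m ℕ.≤ suc r × n ≡ m ℕ.* q a (suc i)
  normLt⇒small-multiple i l r n P′ a≡ 0<n n<q H =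
    let U , V , n≡ , P′≡ = convergent-basis i (+ n) P′
        N , close = absLt⇒eventually (+ n) (- P′) x₂ (- R) (H R)
        j = suc (suc N) ℕ.+ i
        c = K i (suc (suc N))
        d = K (suc i) (suc N)
        e = K (suc (suc i)) N
        L₁≡ = L-on-basis i N U V n≡ P′≡
        L₂≡ = trans (L-on-basis i N (+ l) 1ℤ x₂≡ refl) (cong (λ x → -1ℤ ^ i * (x - + l * + d)) (ℤ.*-identityˡ (+ c)))
    in small-multiple {l} {r} {c} {d} {e} {n} {q a i} {q a (suc i)} {U} {V}
         (cong (λ A → A ℕ.* d ℕ.+ e) a≡) (K-step i N) (q-mono i) 0<n n<q n≡
         (∣∣<∣∣-cancel-±1 (-1^i≡1⊎-1^i≡-1 i)
           (subst₂ ∣_∣<∣_∣ L₁≡ L₂≡ (close j (ℕ.≤-trans (ℕ.m≤n+m N 2) (ℕ.m≤m+n (suc (suc N)) i)))))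
    where
    R = + l * P (suc i) + 1ℤ * P i
    x₂ = + (l ℕ.* q a (suc i) ℕ.+ q a i)
    x₂≡ : x₂ ≡ + l * Q (suc i) + 1ℤ * Q i
    x₂≡ = trans (pos-*-+ l (q a (suc i)) (q a i)) (cong (λ z → + l * Q (suc i) + z) (sym (ℤ.*-identityˡ (Q i))))

open import Data.Nat.Base using (_≤_; _<_; _∸_; _+_; _*_)

proposition2p2 : (a0 : ℤ) (a : ℕ → ℕ) → (∀ i → 1 ≤ i → 1 ≤ a i) →
    (k l n : ℕ) → 2 ≤ k → 0 < l → l ≤ a k → 0 < n → n < qkl a k l →
    NormLt a0 a n (qkl a k (l ∸ 1)) →
    Σ ℕ λ m → 1 ≤ m × m ≤ l × m ≤ a k ∸ l + 1 × n ≡ m * q a (k ∸ 1)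
proposition2p2 a0 a a-pos (suc (suc i)) (suc l) n _ _ l≤a 0<n n<q (P′ , H) =
  let r , l+r≡a = ℕ.m≤n⇒∃[o]m+o≡n l≤a
      m , 1≤m , m≤l , m≤1+r , n≡ = Convergents.normLt⇒small-multiple a0 a a-pos i l r n P′ (sym l+r≡a) 0<n n<q H
  in m , 1≤m , m≤l , subst (m ≤_) (excess l+r≡a) m≤1+r , n≡
  where
  excess : ∀ {r A} → suc l + r ≡ A → suc r ≡ A ∸ suc l + 1
  excess {r} refl = trans (ℕ.+-comm 1 r) (cong (_+ 1) (sym (ℕ.m+n∸m≡n (suc l) r)))
proposition2p2 _ _ _ zero _ _ () _ _ _ _ _
proposition2p2 _ _ _ (suc zero) _ _ (s≤s ()) _ _ _ _ _
proposition2p2 _ _ _ (suc (suc _)) zero _ _ () _ _ _ _
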